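{- Let $v\in\mathcal L(\mathbf p)$, $v\neq\varepsilon$. Then: (1) $v$ is left special with $0v,2v\in\mathcal L(\mathbf p)$ if and only if $v$ is a prefix of $1\varphi(w)$ for some left special $w$ with $0w,1w\in\mathcal L(\mathbf p)$; (2) $v$ is left special with $0v,1v\in\mathcal L(\mathbf p)$ if and only if $v$ is a prefix of $\varphi(w)$ for some left special $w$ with $0w,2w\in\mathcal L(\mathbf p)$.
   Context: $\varphi$ is the morphism on $\{0,1,2\}^*$ given by $\varphi(0)=01$, $\varphi(1)=21$, $\varphi(2)=0$, and $\mathbf p=0121021010\cdots$ is its infinite fixed point. $\mathcal L(\mathbf u)$ denotes the set of finite factors of an infinite word $\mathbf u$. A factor $w$ is left special if $aw,bw\in\mathcal L(\mathbf u)$ for two distinct letters $a,b$. -}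

module Defs where

open import Data.Nat using (ℕ; zero; suc; _+_)
open import Data.List using (List; []; _∷_; _++_; concatMap; length; take; drop; map)
open import Data.List.Base using (upTo)
open import Data.Product using (∃; _×_; _,_)
open import Relation.Binary.PropositionalEquality using (_≡_)
open import Relation.Nullary using (¬_)

data Letter : Set where
  a0 a1 a2 : Letter

Word : Set
Word = List Letter

φl : Letter → Word
φl a0 = a0 ∷ a1 ∷ []
φl a1 = a2 ∷ a1 ∷ []
φl a2 = a0 ∷ []

φ : Word → Word
φ = concatMap φl

φ^ : ℕ → Word → Word
φ^ zero w = w
φ^ (suc n) w = φ (φ^ n w)

-- i-th element of a word, with default 0 (never used out of range below)
at : Word → ℕ → Letter
at [] _ = a0
at (x ∷ _) zero = x
at (_ ∷ xs) (suc i) = at xs i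

-- The fixed point p = lim φⁿ(0).  φⁿ(0) is a prefix of φⁿ⁺¹(0) and
-- |φⁿ(0)| ≥ n + 1, so the i-th letter of p is the i-th letter of φ^(i+1)(0).
p : ℕ → Letter
p i = at (φ^ (suc i) (a0 ∷ [])) i

factorAt : ℕ → ℕ → Word
factorAt i n = map (λ k → p (i + k)) (upTo n)

InL : Word → Set
InL w = ∃ λ i → factorAt i (length w) ≡ w

LeftSpecial : Word → Set
LeftSpecial w = ∃ λ a → ∃ λ b → ¬ (a ≡ b) × InL (a ∷ w) × InL (b ∷ w)

IsPrefix : Word → Word → Set
IsPrefix v u = ∃ λ s → v ++ s ≡ u

-- Since p = φ(p), every position of p is the first letter of a block φ(p j) or the second
-- letter of a block 01 or 21. Hence 00, 11 and 2x (x ≠ 1) are not factors, and every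
-- occurrence of 01, 21, 02 or 12 is the image of a unique occurrence of a letter. So when
-- 0v and cv are factors (c = 2, resp. 1), they desubstitute to factors 0u₁ and c′u₂
-- (c′ = 1, resp. 2) whose images both begin with v less its first letter (resp. with v), and
-- the common prefix w of u₁ and u₂ is the left special word sought. As φ0 = 01 and φ2 = 0
-- share their first letter, φw may fall short by one letter 0; this is repaired by a common
-- right extension x of 0w and c′w, which begins with 0 after applying φ and exists by
-- induction on |w|, through the same desubstitution.

module Submission where

open import Defs
open import Data.Empty using (⊥-elim)
open import Data.List using ([]; _∷_; _++_; _∷ʳ_; [_]; length; map; applyUpTo; upTo)
open import Data.List.Properties
  using (concatMap-++; map-applyUpTo; applyUpTo-∷ʳ; map-cong; length-map; length-applyUpTo;
         length-++; ++-assoc; ++-identityʳ; ++-cancelˡ; ∷-injective)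
open import Data.Nat using (ℕ; zero; suc; _+_; _≤_; _<_; z≤n; s≤s; z<s)
open import Data.Nat.Induction using (<-wellFounded)
open import Data.Nat.Properties using (+-suc; +-identityʳ; +-comm; ≤-trans; ≤-pred; ≤-<-trans; ≤-total; n≤1+n; m<m+n; m<n⇒m<1+n)
open import Data.Product using (∃; _×_; _,_; proj₁; proj₂)
open import Data.Sum using (_⊎_; inj₁; inj₂; [_,_]′)
import Data.Sum as Sum
import Data.Product as Product
open import Data.Unit using (⊤; tt)
open import Function.Bundles using (_⇔_; mk⇔; Equivalence)
open import Induction.WellFounded using (module All)
open import Relation.Binary.Construct.On as On using ()
open import Relation.Binary.PropositionalEquality using (_≡_; _≢_; refl; sym; trans; cong; cong₂; subst; module ≡-Reasoning)
open import Relation.Nullary using (¬_)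

-- Occurrences in p

OccursAt : ℕ → Word → Set
OccursAt i []      = ⊤
OccursAt i (c ∷ w) = p i ≡ c × OccursAt (suc i) w

occurs-++⁻ : ∀ i u {v} → OccursAt i (u ++ v) → OccursAt i u × OccursAt (i + length u) v
occurs-++⁻ i [] {v} o = tt , subst (λ k → OccursAt k v) (sym (+-identityʳ i)) o
occurs-++⁻ i (c ∷ u) {v} (e , o) with occurs-++⁻ (suc i) u o
... | oᵤ , oᵥ = (e , oᵤ) , subst (λ k → OccursAt k v) (sym (+-suc i (length u))) oᵥ

occurs-++⁺ : ∀ i u {v} → OccursAt i u → OccursAt (i + length u) v → OccursAt i (u ++ v)
occurs-++⁺ i [] {v} _ o = subst (λ k → OccursAt k v) (+-identityʳ i) o
occurs-++⁺ i (c ∷ u) {v} (e , oᵤ) oᵥ =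
  e , occurs-++⁺ (suc i) u oᵤ (subst (λ k → OccursAt k v) (+-suc i (length u)) oᵥ)

occurs-≼ : ∀ {i u v} → IsPrefix u v → OccursAt i v → OccursAt i u
occurs-≼ {i} {u} (r , refl) o = proj₁ (occurs-++⁻ i u o)

occurs-unique : ∀ i u v → OccursAt i u → OccursAt i v → length u ≤ length v → IsPrefix u v
occurs-unique i []      v       _       _       _       = v , refl
occurs-unique i (c ∷ u) (d ∷ v) (e , o) (e′ , o′) (s≤s l) with occurs-unique (suc i) u v o o′ l
... | r , eq = r , cong₂ _∷_ (trans (sym e) e′) eq

factorAt-suc : ∀ i n → factorAt i (suc n) ≡ p i ∷ factorAt (suc i) n
factorAt-suc i n = begin
  factorAt i (suc n)                                  ≡⟨ map-applyUpTo (λ k → k) (λ k → p (i + k)) (suc n) ⟩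
  p (i + 0) ∷ applyUpTo (λ k → p (i + suc k)) n      ≡⟨ cong (p (i + 0) ∷_) (sym (map-applyUpTo (λ k → k) _ n)) ⟩
  p (i + 0) ∷ map (λ k → p (i + suc k)) (upTo n)     ≡⟨ cong₂ _∷_ (cong p (+-identityʳ i)) (map-cong (λ k → cong p (+-suc i k)) (upTo n)) ⟩
  p i ∷ factorAt (suc i) n                            ∎
  where open ≡-Reasoning

factorAt-∷ʳ : ∀ i n → factorAt i (suc n) ≡ factorAt i n ∷ʳ p (i + n)
factorAt-∷ʳ i n = begin
  factorAt i (suc n)                                ≡⟨ map-applyUpTo (λ k → k) (λ k → p (i + k)) (suc n) ⟩
  applyUpTo (λ k → p (i + k)) (suc n)               ≡⟨ sym (applyUpTo-∷ʳ (λ k → p (i + k)) n) ⟩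
  applyUpTo (λ k → p (i + k)) n ∷ʳ p (i + n)        ≡⟨ cong (_∷ʳ p (i + n)) (sym (map-applyUpTo (λ k → k) _ n)) ⟩
  factorAt i n ∷ʳ p (i + n)                          ∎
  where open ≡-Reasoning

length-factorAt : ∀ i n → length (factorAt i n) ≡ n
length-factorAt i n = trans (length-map _ (upTo n)) (length-applyUpTo (λ k → k) n)

occurs⇔factorAt : ∀ i w → OccursAt i w ⇔ (factorAt i (length w) ≡ w)
occurs⇔factorAt i w = mk⇔ (to i w) (from i w)
  where
  to : ∀ i w → OccursAt i w → factorAt i (length w) ≡ w
  to i []      _       = refl
  to i (c ∷ w) (e , o) = trans (factorAt-suc i (length w)) (cong₂ _∷_ e (to (suc i) w o))
  from : ∀ i w → factorAt i (length w) ≡ w → OccursAt i w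
  from i []      _  = tt
  from i (c ∷ w) eq with ∷-injective (trans (sym (factorAt-suc i (length w))) eq)
  ... | e , eq′ = e , from (suc i) w eq′

occurs-factorAt : ∀ i n → OccursAt i (factorAt i n)
occurs-factorAt i n = Equivalence.from (occurs⇔factorAt i (factorAt i n)) (cong (factorAt i) (length-factorAt i n))

InL⇒occurs : ∀ {w} → InL w → ∃ λ i → OccursAt i w
InL⇒occurs {w} (i , eq) = i , Equivalence.from (occurs⇔factorAt i w) eq

occurs⇒InL : ∀ {i w} → OccursAt i w → InL w
occurs⇒InL {i} {w} o = i , Equivalence.to (occurs⇔factorAt i w) o

InL-++⁻ˡ : ∀ u {v} → InL (u ++ v) → InL u
InL-++⁻ˡ u h with InL⇒occurs h
... | i , o = occurs⇒InL (proj₁ (occurs-++⁻ i u o))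

InL-++⁻ʳ : ∀ u {v} → InL (u ++ v) → InL v
InL-++⁻ʳ u h with InL⇒occurs h
... | i , o = occurs⇒InL (proj₂ (occurs-++⁻ i u o))

InL-∷⁻ : ∀ {c w} → InL (c ∷ w) → InL w
InL-∷⁻ {c} = InL-++⁻ʳ [ c ]

InL-≼ : ∀ {u v} → IsPrefix u v → InL v → InL u
InL-≼ {u} (r , refl) = InL-++⁻ˡ u

-- p is the fixed point of φ

φ-∷ʳ : ∀ w c → φ (w ∷ʳ c) ≡ φ w ++ φl c
φ-∷ʳ w c = trans (concatMap-++ φl w [ c ]) (cong (φ w ++_) (++-identityʳ (φl c)))

length-φ : ∀ w → length w ≤ length (φ w)
length-φ []       = z≤n
length-φ (a0 ∷ w) = s≤s (≤-trans (length-φ w) (n≤1+n _))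
length-φ (a1 ∷ w) = s≤s (≤-trans (length-φ w) (n≤1+n _))
length-φ (a2 ∷ w) = s≤s (length-φ w)

≼-++⁺ˡ : ∀ x {s y} → IsPrefix s y → IsPrefix (x ++ s) (x ++ y)
≼-++⁺ˡ x {s} (r , refl) = r , ++-assoc x s r

φ-≼ : ∀ {u v} → IsPrefix u v → IsPrefix (φ u) (φ v)
φ-≼ {u} (r , refl) = φ r , sym (concatMap-++ φl u r)

φ^-head : ∀ n → ∃ λ r → φ^ n [ a0 ] ≡ a0 ∷ r
φ^-head zero = [] , refl
φ^-head (suc n) with φ^-head n
... | r , eq = a1 ∷ φ r , cong φ eq

φ^-≼ : ∀ {m n} → m ≤ n → IsPrefix (φ^ m [ a0 ]) (φ^ n [ a0 ])
φ^-≼ {zero} {n} _ with φ^-head n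
... | r , eq = r , sym eq
φ^-≼ (s≤s m≤n) = φ-≼ (φ^-≼ m≤n)

<-length-φ^ : ∀ n → n < length (φ^ n [ a0 ])
<-length-φ^ zero = s≤s z≤n
<-length-φ^ (suc n) with φ^-head n | <-length-φ^ n
... | r , eq | n<∣a0∷r∣ rewrite eq = s≤s (s≤s (≤-trans (≤-pred n<∣a0∷r∣) (length-φ r)))

at-++ : ∀ u {t} k → k < length u → at (u ++ t) k ≡ at u k
at-++ (c ∷ u) zero    _       = refl
at-++ (c ∷ u) (suc k) (s≤s l) = at-++ u k l

p-φ^ : ∀ n k → k < length (φ^ n [ a0 ]) → p k ≡ at (φ^ n [ a0 ]) k
p-φ^ n k k<∣Pn∣ with ≤-total n (suc k)
... | inj₁ n≤k+1 with φ^-≼ n≤k+1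
...   | r , eq = trans (cong (λ w → at w k) (sym eq)) (at-++ (φ^ n [ a0 ]) k k<∣Pn∣)
p-φ^ n k k<∣Pn∣ | inj₂ k+1≤n with φ^-≼ k+1≤n
...   | r , eq = sym (trans (cong (λ w → at w k) (sym eq))
                            (at-++ (φ^ (suc k) [ a0 ]) k (≤-trans (n≤1+n (suc k)) (<-length-φ^ (suc k)))))

occurs-pointwise : ∀ i u → (∀ k → k < length u → p (i + k) ≡ at u k) → OccursAt i u
occurs-pointwise i []      _ = tt
occurs-pointwise i (c ∷ u) h =
  trans (cong p (sym (+-identityʳ i))) (h 0 (s≤s z≤n)) ,
  occurs-pointwise (suc i) u (λ k l → trans (cong p (sym (+-suc i k))) (h (suc k) (s≤s l)))

occurs-φ^ : ∀ n → OccursAt 0 (φ^ n [ a0 ])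
occurs-φ^ n = occurs-pointwise 0 (φ^ n [ a0 ]) (p-φ^ n)

-- Since p = φ(p), the block φ(p j) occurs in p at position pos j.
pos : ℕ → ℕ
pos j = length (φ (factorAt 0 j))

φ-factorAt-suc : ∀ j → φ (factorAt 0 (suc j)) ≡ φ (factorAt 0 j) ++ φl (p j)
φ-factorAt-suc j = trans (cong φ (factorAt-∷ʳ 0 j)) (φ-∷ʳ (factorAt 0 j) (p j))

pos-suc : ∀ j → pos (suc j) ≡ length (φl (p j)) + pos j
pos-suc j = trans (cong length (φ-factorAt-suc j)) (trans (length-++ (φ (factorAt 0 j))) (+-comm (pos j) _))

occurs-φ-factorAt : ∀ n → OccursAt 0 (φ (factorAt 0 n))
occurs-φ-factorAt n = occurs-≼ (φ-≼ factorAt≼φ^) (occurs-φ^ (suc n))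
  where
  factorAt≼φ^ : IsPrefix (factorAt 0 n) (φ^ n [ a0 ])
  factorAt≼φ^ = occurs-unique 0 _ _ (occurs-factorAt 0 n) (occurs-φ^ n)
    (subst (_≤ length (φ^ n [ a0 ])) (sym (length-factorAt 0 n)) (≤-trans (n≤1+n n) (<-length-φ^ n)))

occurs-block : ∀ j → OccursAt (pos j) (φl (p j))
occurs-block j = proj₂ (occurs-++⁻ 0 (φ (factorAt 0 j)) (subst (OccursAt 0) (φ-factorAt-suc j) (occurs-φ-factorAt (suc j))))

occurs-φ : ∀ i w → OccursAt i w → OccursAt (pos i) (φ w)
occurs-φ i []      _          = tt
occurs-φ i (c ∷ w) (refl , o) = occurs-++⁺ (pos i) (φl (p i)) (occurs-block i)
  (subst (λ k → OccursAt k (φ w)) (trans (pos-suc i) (+-comm _ (pos i))) (occurs-φ (suc i) w o))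

InL-φ : ∀ {w} → InL w → InL (φ w)
InL-φ h with InL⇒occurs h
... | i , o = occurs⇒InL (occurs-φ i _ o)

-- Recognizability

φ-head : Letter → Letter
φ-head a0 = a0
φ-head a1 = a2
φ-head a2 = a0

φ-tail : Letter → Word
φ-tail a0 = [ a1 ]
φ-tail a1 = [ a1 ]
φ-tail a2 = []

φl-head-tail : ∀ c → φl c ≡ φ-head c ∷ φ-tail c
φl-head-tail a0 = refl
φl-head-tail a1 = refl
φl-head-tail a2 = refl

φ-head≢a1 : ∀ c → φ-head c ≢ a1
φ-head≢a1 a0 ()
φ-head≢a1 a1 ()
φ-head≢a1 a2 ()

φ-head≡a2 : ∀ {c} → φ-head c ≡ a2 → c ≡ a1
φ-head≡a2 {a1} _ = refl

φl-long : ∀ {c} → φ-tail c ≡ [ a1 ] → φl c ≡ φ-head c ∷ a1 ∷ []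
φl-long {c} t = trans (φl-head-tail c) (cong (φ-head c ∷_) t)

p-pos : ∀ j → p (pos j) ≡ φ-head (p j)
p-pos j = proj₁ (subst (OccursAt (pos j)) (φl-head-tail (p j)) (occurs-block j))

p-suc-pos : ∀ j → φ-tail (p j) ≡ [ a1 ] → p (suc (pos j)) ≡ a1
p-suc-pos j t = proj₁ (proj₂ (subst (OccursAt (pos j)) (φl-long t) (occurs-block j)))

pos-suc-long : ∀ j → φ-tail (p j) ≡ [ a1 ] → pos (suc j) ≡ suc (suc (pos j))
pos-suc-long j t = trans (pos-suc j) (cong (λ w → length w + pos j) (φl-long t))

data Parse : ℕ → Set where
  block-start  : ∀ j → Parse (pos j)
  block-second : ∀ j → φ-tail (p j) ≡ [ a1 ] → Parse (suc (pos j))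

parse : ∀ i → Parse i
parse zero = block-start 0
parse (suc i) with parse i
... | block-second j t = subst Parse (pos-suc-long j t) (block-start (suc j))
... | block-start j with p j in q | pos-suc j
...   | a0 | _ = block-second j (cong φ-tail q)
...   | a1 | _ = block-second j (cong φ-tail q)
...   | a2 | e = subst Parse e (block-start (suc j))

a2-position : ∀ i → p i ≡ a2 → ∃ λ j → i ≡ pos j × p j ≡ a1
a2-position i e with parse i
... | block-start j    = j , refl , φ-head≡a2 (trans (sym (p-pos j)) e)
... | block-second j t with () ← trans (sym (p-suc-pos j t)) e

after-a2 : ∀ i → p i ≡ a2 → p (suc i) ≡ a1
after-a2 i e with a2-position i e
... | j , refl , q = p-suc-pos j (cong φ-tail q)

after-a0 : ∀ i → p i ≡ a0 →
  (p (suc i) ≡ a1 × ∃ λ j → p j ≡ a0 × suc (suc i) ≡ pos (suc j)) ⊎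
  (p (suc i) ≡ a2 × ∃ λ j → p j ≡ a2 × suc i ≡ pos (suc j))
after-a0 i e with parse i
... | block-second j t with () ← trans (sym (p-suc-pos j t)) e
... | block-start j with p j in q | pos-suc j | p-pos j
...   | a0 | s | _ = inj₁ (p-suc-pos j (cong φ-tail q) , j , q , sym s)
...   | a2 | s | _ = inj₂ (trans (cong p (sym s)) (trans (p-pos (suc j)) (cong φ-head (after-a2 j q))) , j , q , sym s)
...   | a1 | _ | h with () ← trans (sym h) e

after-a1 : ∀ i → p i ≡ a1 → ∃ λ j → φ-tail (p j) ≡ [ a1 ] × suc i ≡ pos (suc j)
after-a1 i e with parse i
... | block-start j with () ← φ-head≢a1 (p j) (trans (sym (p-pos j)) e)
... | block-second j t = j , t , sym (pos-suc-long j t)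

after-a1-not-a1 : ∀ i → p i ≡ a1 → p (suc i) ≢ a1
after-a1-not-a1 i e e′ with after-a1 i e
... | j , _ , s = φ-head≢a1 (p (suc j)) (trans (sym (p-pos (suc j))) (trans (cong p (sym s)) e′))

no-a0a0 : ∀ {r} → ¬ InL (a0 ∷ a0 ∷ r)
no-a0a0 h with InL⇒occurs h
... | i , e , e′ , _ with after-a0 i e
...   | inj₁ (e₁ , _) with () ← trans (sym e′) e₁
...   | inj₂ (e₂ , _) with () ← trans (sym e′) e₂

no-a1a1 : ∀ {r} → ¬ InL (a1 ∷ a1 ∷ r)
no-a1a1 h with InL⇒occurs h
... | i , e , e′ , _ = after-a1-not-a1 i e e′

a2-then-a1 : ∀ {c r} → InL (a2 ∷ c ∷ r) → c ≡ a1
a2-then-a1 h with InL⇒occurs h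
... | i , e , e′ , _ = trans (sym e′) (after-a2 i e)

Preimage : Letter → Word → Set
Preimage c s = ∃ λ u → InL (c ∷ u) × IsPrefix s (φ u)

desubst-at : ∀ j {c s} → p j ≡ c → OccursAt (pos (suc j)) s → Preimage c s
desubst-at j {c} {s} q o = u , occurs⇒InL {i = j} (q , oᵤ) , occurs-unique (pos (suc j)) s (φ u) o (occurs-φ (suc j) u oᵤ) ∣s∣≤∣φu∣
  where
  u = factorAt (suc j) (length s)
  oᵤ : OccursAt (suc j) u
  oᵤ = occurs-factorAt (suc j) (length s)
  ∣s∣≤∣φu∣ : length s ≤ length (φ u)
  ∣s∣≤∣φu∣ = subst (_≤ length (φ u)) (length-factorAt (suc j) (length s)) (length-φ u)

desubst-01 : ∀ {s} → InL (a0 ∷ a1 ∷ s) → Preimage a0 s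
desubst-01 {s} h with InL⇒occurs h
... | i , e , e′ , o with after-a0 i e
...   | inj₁ (_ , j , q , i+2≡) = desubst-at j q (subst (λ k → OccursAt k s) i+2≡ o)
...   | inj₂ (e₂ , _) with () ← trans (sym e′) e₂

desubst-02 : ∀ {s} → InL (a0 ∷ a2 ∷ s) → Preimage a2 (a2 ∷ s)
desubst-02 {s} h with InL⇒occurs h
... | i , e , e′ , o with after-a0 i e
...   | inj₁ (e₁ , _) with () ← trans (sym e′) e₁
...   | inj₂ (_ , j , q , i+1≡) = desubst-at j q (subst (λ k → OccursAt k (a2 ∷ s)) i+1≡ (e′ , o))

desubst-21 : ∀ {s} → InL (a2 ∷ a1 ∷ s) → Preimage a1 s
desubst-21 {s} h with InL⇒occurs h
... | i , e , _ , o with a2-position i e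
...   | j , refl , q = desubst-at j q (subst (λ k → OccursAt k s) (sym (pos-suc-long j (cong φ-tail q))) o)

desubst-12 : ∀ {s} → InL (a1 ∷ a2 ∷ s) → Preimage a0 (a2 ∷ s)
desubst-12 {s} h with InL⇒occurs h
... | i , e , e′ , o with after-a1 i e
...   | j , t , i+1≡ with p j in q | t
...     | a0 | _ = desubst-at j q (subst (λ k → OccursAt k (a2 ∷ s)) i+1≡ (e′ , o))
...     | a1 | _ = ⊥-elim (after-a1-not-a1 j q
                      (φ-head≡a2 (trans (sym (p-pos (suc j))) (trans (cong p (sym i+1≡)) e′))))
...     | a2 | ()

-- Common preimages

≼-++⁻ˡ : ∀ x {t y} → IsPrefix (x ++ t) (x ++ y) → IsPrefix t y
≼-++⁻ˡ x {t} {y} (r , e) = r , ++-cancelˡ x (t ++ r) y (trans (sym (++-assoc x t r)) e)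

≼-++ : ∀ x {s y} → IsPrefix s (x ++ y) → IsPrefix s x ⊎ ∃ λ t → s ≡ x ++ t × IsPrefix t y
≼-++ []      {s}     h       = inj₂ (s , refl , h)
≼-++ (c ∷ x) {[]}    _       = inj₁ (c ∷ x , refl)
≼-++ (c ∷ x) {d ∷ s} (r , e) with ∷-injective e
... | refl , e′ with ≼-++ x (r , e′)
...   | inj₁ (t , et)        = inj₁ (t , cong (c ∷_) et)
...   | inj₂ (t , refl , pr) = inj₂ (t , refl , pr)

φ-head-of-≼ : ∀ {c s} a u → IsPrefix (c ∷ s) (φ (a ∷ u)) → c ≡ φ-head a
φ-head-of-≼ a u (r , e) = proj₁ (∷-injective (trans e (cong (_++ φ u) (φl-head-tail a))))

¬a1≼φ : ∀ {s} u → ¬ IsPrefix (a1 ∷ s) (φ u)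
¬a1≼φ []      (_ , ())
¬a1≼φ (a ∷ u) h = φ-head≢a1 a (sym (φ-head-of-≼ a u h))

data HeadMatch : Letter → Letter → Set where
  same   : ∀ {a} → HeadMatch a a
  fork₀₂ : HeadMatch a0 a2
  fork₂₀ : HeadMatch a2 a0

headMatch : ∀ a b → φ-head a ≡ φ-head b → HeadMatch a b
headMatch a0 a0 _ = same
headMatch a1 a1 _ = same
headMatch a2 a2 _ = same
headMatch a0 a2 _ = fork₀₂
headMatch a2 a0 _ = fork₂₀
headMatch a0 a1 ()
headMatch a1 a0 ()
headMatch a1 a2 ()
headMatch a2 a1 ()

-- φ0 = 01 and φ2 = 0 are the only images sharing a first letter, and no image begins with 1:
-- a common prefix of φu₁ and φu₂ exceeds φw, for w the longest common prefix of u₁ and u₂,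
-- by at most one letter 0.
CommonPreimage : Word → Word → Word → Set
CommonPreimage s u₁ u₂ = ∃ λ w → IsPrefix w u₁ × IsPrefix w u₂ ×
  (IsPrefix s (φ w) ⊎ (s ≡ φ w ∷ʳ a0 × (IsPrefix (w ∷ʳ a0) u₁ ⊎ IsPrefix (w ∷ʳ a0) u₂)))

CommonPreimage-[] : ∀ {u₁ u₂} → CommonPreimage [] u₁ u₂
CommonPreimage-[] {u₁} {u₂} = [] , (u₁ , refl) , (u₂ , refl) , inj₁ ([] , refl)

CommonPreimage-swap : ∀ {s u₁ u₂} → CommonPreimage s u₁ u₂ → CommonPreimage s u₂ u₁
CommonPreimage-swap (w , w≼u₁ , w≼u₂ , inj₁ s≼φw)   = w , w≼u₂ , w≼u₁ , inj₁ s≼φw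
CommonPreimage-swap (w , w≼u₁ , w≼u₂ , inj₂ (e , q)) = w , w≼u₂ , w≼u₁ , inj₂ (e , Sum.swap q)

CommonPreimage-∷ : ∀ a {s u₁ u₂} → CommonPreimage s u₁ u₂ → CommonPreimage (φl a ++ s) (a ∷ u₁) (a ∷ u₂)
CommonPreimage-∷ a (w , w≼u₁ , w≼u₂ , inj₁ s≼φw) =
  a ∷ w , ≼-++⁺ˡ [ a ] w≼u₁ , ≼-++⁺ˡ [ a ] w≼u₂ , inj₁ (≼-++⁺ˡ (φl a) s≼φw)
CommonPreimage-∷ a (w , w≼u₁ , w≼u₂ , inj₂ (refl , q)) =
  a ∷ w , ≼-++⁺ˡ [ a ] w≼u₁ , ≼-++⁺ˡ [ a ] w≼u₂ ,
  inj₂ (sym (++-assoc (φl a) (φ w) [ a0 ]) , Sum.map (≼-++⁺ˡ [ a ]) (≼-++⁺ˡ [ a ]) q)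

CommonPreimage-fork : ∀ {s u₁ u₂} → IsPrefix s (φ (a0 ∷ u₁)) → IsPrefix s (φ (a2 ∷ u₂)) →
                      CommonPreimage s (a0 ∷ u₁) (a2 ∷ u₂)
CommonPreimage-fork {[]}        _        _ = CommonPreimage-[]
CommonPreimage-fork {c ∷ []}    {u₁} (_ , refl) _ = [] , (_ , refl) , (_ , refl) , inj₂ (refl , inj₁ (u₁ , refl))
CommonPreimage-fork {c ∷ d ∷ s} {u₁} {u₂} (r₁ , e₁) (r₂ , e₂) with ∷-injective e₁ | ∷-injective e₂
... | _ , e₁′ | _ , e₂′ with ∷-injective e₁′
...   | refl , _ = ⊥-elim (¬a1≼φ u₂ (r₂ , e₂′))

commonPreimage : ∀ s u₁ u₂ → IsPrefix s (φ u₁) → IsPrefix s (φ u₂) → CommonPreimage s u₁ u₂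
commonPreimage []      _        _        _        _        = CommonPreimage-[]
commonPreimage (c ∷ s) []       _        (_ , ()) _
commonPreimage (c ∷ s) (_ ∷ _)  []       _        (_ , ())
commonPreimage (c ∷ s) (a ∷ u₁) (b ∷ u₂) h₁ h₂
  with headMatch a b (trans (sym (φ-head-of-≼ a u₁ h₁)) (φ-head-of-≼ b u₂ h₂))
... | fork₀₂ = CommonPreimage-fork h₁ h₂
... | fork₂₀ = CommonPreimage-swap (CommonPreimage-fork h₂ h₁)
... | same with ≼-++ (φl a) h₁
...   | inj₁ s≼φa = [ a ] , (u₁ , refl) , (u₂ , refl) , inj₁ (subst (IsPrefix (c ∷ s)) (sym (++-identityʳ (φl a))) s≼φa)
...   | inj₂ (t , e , t≼φu₁) = subst (λ s′ → CommonPreimage s′ (a ∷ u₁) (a ∷ u₂)) (sym e)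
  (CommonPreimage-∷ a (commonPreimage t u₁ u₂ t≼φu₁ (≼-++⁻ˡ (φl a) (subst (λ s′ → IsPrefix s′ (φ (a ∷ u₂))) e h₂))))

-- Left special factors

Special : Letter → Word → Set
Special c w = InL (a0 ∷ w) × InL (c ∷ w)

RightExtendable : Letter → Word → Set
RightExtendable c w = Special c w → ∃ λ x → Special c (w ∷ʳ x)

Special-≼ : ∀ {c u w} → IsPrefix u w → Special c w → Special c u
Special-≼ {c} u≼w (h₀ , h) = InL-≼ (≼-++⁺ˡ [ a0 ] u≼w) h₀ , InL-≼ (≼-++⁺ˡ [ c ] u≼w) h

Special₀₁-φ : ∀ {w} → Special a1 w → Special a2 (a1 ∷ φ w)
Special₀₁-φ (h₀ , h₁) = InL-φ h₀ , InL-φ h₁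

Special₀₂-φ : ∀ {w} → Special a2 w → Special a1 (φ w)
Special₀₂-φ (h₀ , h₂) = InL-φ h₂ , InL-∷⁻ (InL-φ h₀)

SpecialPreimage : Letter → Word → Set
SpecialPreimage c s = ∃ λ w → Special c w × (IsPrefix s (φ w) ⊎ (s ≡ φ w ∷ʳ a0 × InL (w ∷ʳ a0)))

specialPreimage : ∀ c {s} → Preimage a0 s → Preimage c s → SpecialPreimage c s
specialPreimage c {s} (u₁ , g₀ , s≼φu₁) (u₂ , g , s≼φu₂) with commonPreimage s u₁ u₂ s≼φu₁ s≼φu₂
... | w , w≼u₁ , w≼u₂ , rest =
  w , (InL-≼ (≼-++⁺ˡ [ a0 ] w≼u₁) g₀ , InL-≼ (≼-++⁺ˡ [ c ] w≼u₂) g) ,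
  Sum.map₂ (Product.map₂ [ (λ pr → InL-≼ pr (InL-∷⁻ g₀)) , (λ pr → InL-≼ pr (InL-∷⁻ g)) ]′) rest

preceded-by-a0-and-a1 : ∀ {c r} → InL (a0 ∷ c ∷ r) → InL (a1 ∷ c ∷ r) → c ≡ a2
preceded-by-a0-and-a1 {a0} h₀ _  = ⊥-elim (no-a0a0 h₀)
preceded-by-a0-and-a1 {a1} _  h₁ = ⊥-elim (no-a1a1 h₁)
preceded-by-a0-and-a1 {a2} _  _  = refl

followed-by-a0-and-a1 : ∀ w → InL (w ∷ʳ a0) → InL (w ∷ʳ a1) → w ≡ []
followed-by-a0-and-a1 []          _  _  = refl
followed-by-a0-and-a1 (a0 ∷ [])   h₀ _  = ⊥-elim (no-a0a0 h₀)
followed-by-a0-and-a1 (a1 ∷ [])   _  h₁ = ⊥-elim (no-a1a1 h₁)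
followed-by-a0-and-a1 (a2 ∷ [])   h₀ _  with () ← a2-then-a1 h₀
followed-by-a0-and-a1 (c ∷ d ∷ w) h₀ h₁ with followed-by-a0-and-a1 (d ∷ w) (InL-∷⁻ h₀) (InL-∷⁻ h₁)
... | ()

φ-∷ʳ-≼ : ∀ w x → IsPrefix (φ w ∷ʳ φ-head x) (φ (w ∷ʳ x))
φ-∷ʳ-≼ w x = φ-tail x , trans (++-assoc (φ w) [ φ-head x ] (φ-tail x))
                               (sym (trans (φ-∷ʳ w x) (cong (φ w ++_) (φl-head-tail x))))

φ-∷ʳ-≼-a0 : ∀ w {x} → φ-head x ≡ a0 → IsPrefix (φ w ∷ʳ a0) (φ (w ∷ʳ x))
φ-∷ʳ-≼-a0 w {x} hd = subst (λ y → IsPrefix (φ w ∷ʳ y) (φ (w ∷ʳ x))) hd (φ-∷ʳ-≼ w x)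

length-<-φ-∷ʳ : ∀ w a → length w < length (φ w ∷ʳ a)
length-<-φ-∷ʳ w a = subst (length w <_) (sym (length-++ (φ w))) (≤-<-trans (length-φ w) (m<m+n (length (φ w)) z<s))

<-length-φ : ∀ {b u} → InL (a2 ∷ b ∷ u) → length (b ∷ u) < length (φ (b ∷ u))
<-length-φ {u = u} h with a2-then-a1 h
... | refl = s≤s (s≤s (length-φ u))

≼-cases : ∀ {v u} → IsPrefix v u → v ≡ u ⊎ ∃ λ d → IsPrefix (v ∷ʳ d) u
≼-cases {v} ([]    , e) = inj₁ (trans (sym (++-identityʳ v)) e)
≼-cases {v} (d ∷ r , e) = inj₂ (d , r , trans (++-assoc v [ d ] r) e)

rightExtension-φ-head : ∀ {c} w → RightExtendable c w → Special c w → InL (w ∷ʳ a0) →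
  ∃ λ x → Special c (w ∷ʳ x) × (φ-head x ≡ a0 ⊎ (w ≡ [] × x ≡ a1))
rightExtension-φ-head w ext sp w0 = let (x , spx) = ext sp in x , spx , head x (InL-∷⁻ (proj₂ spx))
  where
  head : ∀ x → InL (w ∷ʳ x) → φ-head x ≡ a0 ⊎ (w ≡ [] × x ≡ a1)
  head a0 _  = inj₁ refl
  head a1 w1 = inj₂ (followed-by-a0-and-a1 w w0 w1 , refl)
  head a2 _  = inj₁ refl

fromPreimage₀₂ : ∀ s → (∀ w → length w < length (a1 ∷ s) → RightExtendable a1 w) →
  SpecialPreimage a1 s →
  ∃ λ w → Special a1 w × IsPrefix (a1 ∷ s) (a1 ∷ φ w)
fromPreimage₀₂ s ext (w , sp , inj₁ s≼φw) = w , sp , ≼-++⁺ˡ [ a1 ] s≼φw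
fromPreimage₀₂ s ext (w , sp , inj₂ (refl , w0))
  with rightExtension-φ-head w (ext w (m<n⇒m<1+n (length-<-φ-∷ʳ w a0))) sp w0
... | x , spx , inj₁ hd           = w ∷ʳ x , spx , ≼-++⁺ˡ [ a1 ] (φ-∷ʳ-≼-a0 w hd)
... | x , spx , inj₂ (refl , refl) = ⊥-elim (no-a1a1 (proj₂ spx))

fromPreimage₀₁ : ∀ s → (∀ w → length w < length (a2 ∷ s) → RightExtendable a2 w) →
  SpecialPreimage a2 (a2 ∷ s) →
  ∃ λ w → Special a2 w × IsPrefix (a2 ∷ s) (φ w)
fromPreimage₀₁ s ext (w , sp , inj₁ v≼φw) = w , sp , v≼φw
fromPreimage₀₁ s ext (w , sp , inj₂ (e , w0))
  with rightExtension-φ-head w (ext w (subst (length w <_) (cong length (sym e)) (length-<-φ-∷ʳ w a0))) sp w0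
... | x , spx , inj₁ hd       = w ∷ʳ x , spx , subst (λ v → IsPrefix v (φ (w ∷ʳ x))) (sym e) (φ-∷ʳ-≼-a0 w hd)
... | x , spx , inj₂ (refl , _) with () ← e

desubst₀₂ : ∀ v → (∀ w → length w < length v → RightExtendable a1 w) →
            Special a2 v → ∃ λ w → Special a1 w × IsPrefix v (a1 ∷ φ w)
desubst₀₂ []      _   _         = [] , ((0 , refl) , (1 , refl)) , ([ a1 ] , refl)
desubst₀₂ (c ∷ s) ext (h₀ , h₂) with a2-then-a1 h₂
... | refl = fromPreimage₀₂ s ext (specialPreimage a1 (desubst-01 h₀) (desubst-21 h₂))

desubst₀₁ : ∀ v → (∀ w → length w < length v → RightExtendable a2 w) →
            Special a1 v → ∃ λ w → Special a2 w × IsPrefix v (φ w)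
desubst₀₁ []      _   _         = [] , ((0 , refl) , (2 , refl)) , ([] , refl)
desubst₀₁ (c ∷ s) ext (h₀ , h₁) with preceded-by-a0-and-a1 h₀ h₁
... | refl = fromPreimage₀₁ s ext (specialPreimage a2 (desubst-12 h₁) (desubst-02 h₀))

φ-rightExtension₀₂ : ∀ {w} → RightExtendable a2 w → Special a2 w → ∃ λ x → Special a1 (φ w ∷ʳ x)
φ-rightExtension₀₂ {w} ext sp =
  let (y , spy) = ext sp in φ-head y , Special-≼ (φ-∷ʳ-≼ w y) (Special₀₂-φ spy)

φ-rightExtension₀₁ : ∀ {w} → RightExtendable a1 w → Special a1 w → ∃ λ x → Special a2 (a1 ∷ φ w ∷ʳ x)
φ-rightExtension₀₁ {w} ext sp =
  let (y , spy) = ext sp in φ-head y , Special-≼ (≼-++⁺ˡ [ a1 ] (φ-∷ʳ-≼ w y)) (Special₀₁-φ spy)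

rightExtendable₀₁ : ∀ w → (∀ w′ → length w′ < length w → RightExtendable a2 w′) → RightExtendable a1 w
rightExtendable₀₁ w ext sp = extend (desubst₀₁ w ext sp)
  where
  atImage : ∀ w′ → Special a2 w′ → w ≡ φ w′ → ∃ λ x → Special a1 (φ w′ ∷ʳ x)
  atImage []      _   _      = a2 , (4 , refl) , (1 , refl)
  atImage (b ∷ u) sp′ w≡φw′ = φ-rightExtension₀₂
    (ext (b ∷ u) (subst (length (b ∷ u) <_) (cong length (sym w≡φw′)) (<-length-φ (proj₂ sp′)))) sp′
  extend : (∃ λ w′ → Special a2 w′ × IsPrefix w (φ w′)) → ∃ λ x → Special a1 (w ∷ʳ x)
  extend (w′ , sp′ , w≼φw′) with ≼-cases w≼φw′
  ... | inj₂ (d , wd≼φw′) = d , Special-≼ wd≼φw′ (Special₀₂-φ sp′)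
  ... | inj₁ w≡φw′ = subst (λ u → ∃ λ x → Special a1 (u ∷ʳ x)) (sym w≡φw′) (atImage w′ sp′ w≡φw′)

rightExtendable₀₂ : ∀ w → (∀ w′ → length w′ < length w → RightExtendable a1 w′) → RightExtendable a2 w
rightExtendable₀₂ w ext sp = extend (desubst₀₂ w ext sp)
  where
  extend : (∃ λ w′ → Special a1 w′ × IsPrefix w (a1 ∷ φ w′)) → ∃ λ x → Special a2 (w ∷ʳ x)
  extend (w′ , sp′ , w≼1φw′) with ≼-cases w≼1φw′
  ... | inj₂ (d , wd≼1φw′) = d , Special-≼ wd≼1φw′ (Special₀₁-φ sp′)
  ... | inj₁ w≡1φw′ = subst (λ u → ∃ λ x → Special a2 (u ∷ʳ x)) (sym w≡1φw′)
    (φ-rightExtension₀₁ (ext w′ (subst (length w′ <_) (cong length (sym w≡1φw′)) (s≤s (length-φ w′)))) sp′)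

rightExtendable : ∀ w → RightExtendable a1 w × RightExtendable a2 w
rightExtendable = All.wfRec (On.wellFounded length <-wellFounded) _ _
  λ w rec → rightExtendable₀₁ w (λ _ lt → proj₂ (rec lt)) , rightExtendable₀₂ w (λ _ lt → proj₁ (rec lt))

special₀₂⇔ : ∀ v → Special a2 v ⇔ ∃ λ w → Special a1 w × IsPrefix v (a1 ∷ φ w)
special₀₂⇔ v = mk⇔ (desubst₀₂ v (λ w _ → proj₁ (rightExtendable w)))
                   (λ (w , sp , v≼) → Special-≼ v≼ (Special₀₁-φ sp))

special₀₁⇔ : ∀ v → Special a1 v ⇔ ∃ λ w → Special a2 w × IsPrefix v (φ w)
special₀₁⇔ v = mk⇔ (desubst₀₁ v (λ w _ → proj₂ (rightExtendable w)))
                   (λ (w , sp , v≼) → Special-≼ v≼ (Special₀₂-φ sp))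

leftSpecial-form : ∀ {b c v} {P : Word → Set} → a0 ≢ b → a0 ≢ c →
  (Special b v ⇔ ∃ λ w → Special c w × P w) →
  (LeftSpecial v × InL (a0 ∷ v) × InL (b ∷ v)) ⇔ (∃ λ w → LeftSpecial w × InL (a0 ∷ w) × InL (c ∷ w) × P w)
leftSpecial-form {b} {c} a0≢b a0≢c equiv = mk⇔
  (λ (_ , h₀ , h) → let (w , (g₀ , g) , pw) = Equivalence.to equiv (h₀ , h)
                    in w , (a0 , c , a0≢c , g₀ , g) , g₀ , g , pw)
  (λ (w , _ , g₀ , g , pw) → let (h₀ , h) = Equivalence.from equiv (w , (g₀ , g) , pw)
                             in (a0 , b , a0≢b , h₀ , h) , h₀ , h)

mainTheorem4 : (v : Word) → InL v → ¬ (v ≡ [])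
    → ((LeftSpecial v × InL (a0 ∷ v) × InL (a2 ∷ v))
        ⇔ (∃ λ w → LeftSpecial w × InL (a0 ∷ w) × InL (a1 ∷ w) × IsPrefix v (a1 ∷ φ w)))
    × ((LeftSpecial v × InL (a0 ∷ v) × InL (a1 ∷ v))
        ⇔ (∃ λ w → LeftSpecial w × InL (a0 ∷ w) × InL (a2 ∷ w) × IsPrefix v (φ w)))
mainTheorem4 v _ _ =
  leftSpecial-form (λ ()) (λ ()) (special₀₂⇔ v) ,
  leftSpecial-form (λ ()) (λ ()) (special₀₁⇔ v)
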